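{- Let $n\geq 4$ and let $S_n$ be the $n$-sunlet graph. Then $\psi_E(S_n)=3$.
   Context: All graphs are simple, connected and undirected. The $n$-sunlet graph $S_n$ is obtained from the cycle $C_n$ by attaching one pendant edge at each vertex of the cycle (so it has $n$ cycle edges and $n$ pendant edges). For a graph $G$, the edge distance $d_E(f,g)$ between edges $f,g\in E(G)$ is the distance between $f$ and $g$ as vertices of the line graph $L(G)$. Two edges $f,g$ are said to edge doubly resolve edges $f_1,f_2$ if $d_E(f_1,f)-d_E(f_1,g)\neq d_E(f_2,f)-d_E(f_2,g)$. A set $D_E\subseteq E(G)$ is an edge version of doubly resolving set of $G$ if every pair of distinct edges $e\neq f$ of $G$ is edge doubly resolved by some two edges of $D_E$. $\psi_E(G)$ denotes the minimum cardinality of an edge version of doubly resolving set of $G$. -}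

module Defs where

open import Data.Nat using (ℕ; zero; suc; _≤_; _%_)
open import Data.Nat.DivMod using (m%n<n)
open import Data.Integer using (ℤ; +_; _-_)
open import Data.Fin using (Fin; toℕ; fromℕ<)
open import Data.Sum using (_⊎_; inj₁; inj₂)
open import Data.Product using (_×_; _,_; Σ; ∃-syntax)
open import Data.List using (List; length)
open import Data.List.Membership.Propositional using (_∈_)
open import Data.List.Relation.Unary.Unique.Propositional using (Unique)
open import Relation.Binary.PropositionalEquality using (_≡_; _≢_)

record Graph : Set₁ where
  field
    V    : Set
    E    : Set
    ends : E → V × V

module _ (G : Graph) where
  open Graph G

  _∈ₑ_ : V → E → Set
  v ∈ₑ e with ends e
  ... | a , b = (v ≡ a) ⊎ (v ≡ b)

  LAdj : E → E → Set
  LAdj f g = (f ≢ g) × (∃[ v ] (v ∈ₑ f × v ∈ₑ g))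

  data LWalk : E → E → ℕ → Set where
    here : ∀ {f} → LWalk f f 0
    step : ∀ {f g h k} → LAdj f g → LWalk g h k → LWalk f h (suc k)

  EdgeDist : E → E → ℕ → Set
  EdgeDist f g k = LWalk f g k × (∀ j → LWalk f g j → k ≤ j)

  DoublyResolves : E → E → E → E → Set
  DoublyResolves f g f₁ f₂ =
    ∀ a b c d → EdgeDist f₁ f a → EdgeDist f₁ g b →
                EdgeDist f₂ f c → EdgeDist f₂ g d →
                (+ a - + b) ≢ (+ c - + d)

  IsEdgeDRS : List E → Set
  IsEdgeDRS D = ∀ e f → e ≢ f →
    ∃[ x ] ∃[ y ] (x ∈ D × y ∈ D × DoublyResolves x y e f)

  ψE≡ : ℕ → Set
  ψE≡ k = (Σ (List E) λ D → Unique D × IsEdgeDRS D × length D ≡ k)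
        × (∀ D → Unique D → IsEdgeDRS D → k ≤ length D)

nextMod : ∀ {n} → Fin n → Fin n
nextMod {suc n} i = fromℕ< (m%n<n (suc (toℕ i)) (suc n))

-- Sunlet S_n: cycle vertices inj₁ i, pendant vertices inj₂ i
data SunletEdge (n : ℕ) : Set where
  cyc  : Fin n → SunletEdge n
  pend : Fin n → SunletEdge n

sunletEnds : ∀ {n} → SunletEdge n → (Fin n ⊎ Fin n) × (Fin n ⊎ Fin n)
sunletEnds (cyc i)  = inj₁ i , inj₁ (nextMod i)
sunletEnds (pend i) = inj₁ i , inj₂ i

Sunlet : ℕ → Graph
Sunlet n = record { V = Fin n ⊎ Fin n ; E = SunletEdge n ; ends = sunletEnds }

module Submission where

-- Lower bound: distances are below N for N ≥ 4, and S_N has 2N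
-- edges.  Upper bound: for c₀, c₁, c_h with h = ⌈N/2⌉ the differences
-- d(c₁,e) - d(c₀,e) and d(c_h,e) - d(c₀,e) determine the position of e around
-- the cycle (2t + 1 for c_t, 2t for p_t), computed in each range of t.

open import Defs
open import Data.Nat
  using (ℕ; zero; suc; pred; NonZero; _+_; _∸_; _⊓_; _≤_; _<_; z≤n; s≤s; s≤s⁻¹; _≤?_; _≟_)
open import Data.Nat.Properties
open import Data.Nat.DivMod
  using (_%_; m%n<n; n%n≡0; m<n⇒m%n≡m; %-distribˡ-+; m%n%n≡m%n; m≤n⇒[n∸m]%m≡n%m; [m+n]%n≡m%n)
open import Data.Nat.Tactic.RingSolver using (solve)
open import Data.Fin using (Fin; toℕ; fromℕ<; splitAt; join)
import Data.Fin.Properties as Fin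
open import Data.Sum using (_⊎_; inj₁; inj₂; [_,_]′)
open import Data.Product using (_×_; _,_; ∃-syntax)
open import Data.List using (List; []; _∷_; length)
open import Data.List.Membership.Propositional using (_∈_)
open import Data.List.Relation.Unary.Any using (here; there)
open import Data.List.Relation.Unary.Unique.Propositional using (Unique)
open import Function.Base using (_∘_)
open import Function.Bundles using (_⇔_; mk⇔; Equivalence)
open import Function.Definitions using (Injective)
open import Relation.Binary.Definitions using (DecidableEquality)
open import Relation.Binary.PropositionalEquality
open import Relation.Nullary using (¬_; Dec; yes; no; contradiction)
open import Relation.Nullary.Decidable using (map′)
open import Algebra.Properties.CommutativeSemigroup +-commutativeSemigroup
  using (interchange; xy∙z≈xz∙y; x∙yz≈z∙yx)
open import Algebra.Properties.CommutativeSemigroup ⊓-commutativeSemigroup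
  using () renaming (interchange to ⊓-interchange)

∸-peel : ∀ M k → suc k ≤ M → M ∸ k ≡ suc (M ∸ suc k)
∸-peel (suc M) zero    _       = refl
∸-peel (suc M) (suc k) (s≤s p) = ∸-peel M k p

last-gap : ∀ {M k} → suc k ≡ M → M ∸ k ≡ 1
last-gap {k = k} refl = m+n∸n≡m 1 k

half-mono-≤′ : ∀ {a b} → a + a ≤ suc (b + b) → a ≤ b
half-mono-≤′ {a} {b} le with ≤-<-connex a b
... | inj₁ a≤b = a≤b
... | inj₂ b<a = contradiction le (<⇒≱ (begin
  suc (suc (b + b))  ≡⟨ cong suc (+-suc b b) ⟨
  suc b + suc b      ≤⟨ +-mono-≤ b<a b<a ⟩
  a + a              ∎))
  where open ≤-Reasoning

half-mono-≤ : ∀ {a b} → a + a ≤ b + b → a ≤ b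
half-mono-≤ le = half-mono-≤′ (≤-trans le (n≤1+n _))

half-injective : ∀ {a b} → a + a ≡ b + b → a ≡ b
half-injective eq = ≤-antisym (half-mono-≤ (≤-reflexive eq)) (half-mono-≤ (≤-reflexive (sym eq)))

double≢odd : ∀ a b → a + a ≢ suc (b + b)
double≢odd a b eq = even≢odd a b (trans (cong (a +_) (+-identityʳ a))
                                 (trans eq (cong (λ c → suc (b + c)) (sym (+-identityʳ b)))))

complement-first : ∀ a b {M} → a + b ≡ M → M ≤ b + b → a + a ≤ M
complement-first a b {M} eq M≤2b = +-cancelʳ-≤ (b + b) (a + a) M (begin
  a + a + (b + b)  ≡⟨ interchange a a b b ⟩
  a + b + (a + b)  ≡⟨ cong₂ _+_ eq eq ⟩
  M + M            ≤⟨ +-monoʳ-≤ M M≤2b ⟩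
  M + (b + b)      ∎)
  where open ≤-Reasoning

complement-second : ∀ a b {M} → a + b ≡ M → b + b ≤ M → M ≤ a + a
complement-second a b {M} eq 2b≤M = +-cancelʳ-≤ (b + b) M (a + a) (begin
  M + (b + b)      ≤⟨ +-monoʳ-≤ M 2b≤M ⟩
  M + M            ≡⟨ cong₂ _+_ eq eq ⟨
  a + b + (a + b)  ≡⟨ interchange a b a b ⟩
  a + a + (b + b)  ∎)
  where open ≤-Reasoning

≤-by : ∀ {a b} c → a + c ≡ b → a ≤ b
≤-by {a} c eq = ≤-trans (m≤m+n a c) (≤-reflexive eq)

shift-one : ∀ {x y k t M} → x + t ≡ M → y + k ≡ M → k + 1 ≡ t → x + 1 ≡ y
shift-one {x} {y} {k} {t} {M} ex ey ek = +-cancelʳ-≡ k _ _ (begin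
  x + 1 + k    ≡⟨ +-assoc x 1 k ⟩
  x + (1 + k)  ≡⟨ cong (x +_) (trans (+-comm 1 k) ek) ⟩
  x + t        ≡⟨ trans ex (sym ey) ⟩
  y + k        ∎)
  where open ≡-Reasoning

cancel-offsets : ∀ {a b c a′ b′ c′ K} →
                 a + c ≡ b + K → a′ + c′ ≡ b′ + K → b + a′ ≡ b′ + a → c ≡ c′
cancel-offsets {a} {b} {c} {a′} {b′} {c′} {K} e e′ E = +-cancelˡ-≡ (a + a′) _ _ (begin
  a + a′ + c      ≡⟨ xy∙z≈xz∙y a a′ c ⟩
  a + c + a′      ≡⟨ cong (_+ a′) e ⟩
  b + K + a′      ≡⟨ xy∙z≈xz∙y b K a′ ⟩
  b + a′ + K      ≡⟨ cong (_+ K) E ⟩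
  b′ + a + K      ≡⟨ xy∙z≈xz∙y b′ a K ⟩
  b′ + K + a      ≡⟨ cong (_+ a) e′ ⟨
  a′ + c′ + a     ≡⟨ solve (a ∷ a′ ∷ c′ ∷ []) ⟩
  a + a′ + c′     ∎)
  where open ≡-Reasoning

offset-cancel : ∀ {B p q r s} → q ≤ B → s ≤ B → p + (B ∸ q) ≡ r + (B ∸ s) → p + s ≡ r + q
offset-cancel {B} {p} {q} {r} {s} q≤B s≤B eq = +-cancelʳ-≡ B (p + s) (r + q) (begin
  p + s + B                ≡⟨ cong (p + s +_) (m∸n+n≡m q≤B) ⟨
  p + s + (B ∸ q + q)      ≡⟨ interchange p s (B ∸ q) q ⟩
  p + (B ∸ q) + (s + q)    ≡⟨ cong (_+ (s + q)) eq ⟩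
  r + (B ∸ s) + (s + q)    ≡⟨ cong (r + (B ∸ s) +_) (+-comm s q) ⟩
  r + (B ∸ s) + (q + s)    ≡⟨ interchange r (B ∸ s) q s ⟩
  r + q + (B ∸ s + s)      ≡⟨ cong (r + q +_) (m∸n+n≡m s≤B) ⟩
  r + q + B                ∎)
  where open ≡-Reasoning

-- An equation between differences of naturals, read in ℤ, is a cross-sum
-- equation in ℕ; this translates double resolution into ℕ.
module _ where
  open import Data.Integer as ℤ using (+_)
  import Data.Integer.Properties as ℤ
  import Data.Integer.Tactic.RingSolver as ℤ-Solver

  difference≡⇔cross-sum : ∀ a b c d → (+ a ℤ.- + b ≡ + c ℤ.- + d) ⇔ (a + d ≡ c + b)
  difference≡⇔cross-sum a b c d = mk⇔ to from
    where
      open ≡-Reasoning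
      add-backˡ : ∀ x y w → (x ℤ.- y) ℤ.+ (y ℤ.+ w) ≡ x ℤ.+ w
      add-backˡ = ℤ-Solver.solve-∀
      add-backʳ : ∀ x y w → (x ℤ.- y) ℤ.+ (w ℤ.+ y) ≡ x ℤ.+ w
      add-backʳ = ℤ-Solver.solve-∀
      shift : ∀ x y w → x ℤ.- y ≡ (x ℤ.+ w) ℤ.- (y ℤ.+ w)
      shift = ℤ-Solver.solve-∀
      unshift : ∀ x y w → (x ℤ.+ y) ℤ.- (y ℤ.+ w) ≡ x ℤ.- w
      unshift = ℤ-Solver.solve-∀

      to : + a ℤ.- + b ≡ + c ℤ.- + d → a + d ≡ c + b
      to eq = ℤ.+-injective (begin
        + (a + d)                        ≡⟨ ℤ.pos-+ a d ⟩
        + a ℤ.+ + d                      ≡⟨ add-backˡ (+ a) (+ b) (+ d) ⟨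
        (+ a ℤ.- + b) ℤ.+ (+ b ℤ.+ + d)  ≡⟨ cong (ℤ._+ (+ b ℤ.+ + d)) eq ⟩
        (+ c ℤ.- + d) ℤ.+ (+ b ℤ.+ + d)  ≡⟨ add-backʳ (+ c) (+ d) (+ b) ⟩
        + c ℤ.+ + b                      ≡⟨ ℤ.pos-+ c b ⟨
        + (c + b)                        ∎)

      from : a + d ≡ c + b → + a ℤ.- + b ≡ + c ℤ.- + d
      from eq = begin
        + a ℤ.- + b                      ≡⟨ shift (+ a) (+ b) (+ d) ⟩
        (+ a ℤ.+ + d) ℤ.- (+ b ℤ.+ + d)  ≡⟨ cong (ℤ._- (+ b ℤ.+ + d)) sums ⟩
        (+ c ℤ.+ + b) ℤ.- (+ b ℤ.+ + d)  ≡⟨ unshift (+ c) (+ b) (+ d) ⟩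
        + c ℤ.- + d                      ∎
        where
          sums : + a ℤ.+ + d ≡ + c ℤ.+ + b
          sums = trans (sym (ℤ.pos-+ a d)) (trans (cong +_ eq) (ℤ.pos-+ c b))

module _ (G : Graph) where
  open Graph G

  EdgeDist-unique : ∀ {e x a b} → EdgeDist G e x a → EdgeDist G e x b → a ≡ b
  EdgeDist-unique (walk-a , min-a) (walk-b , min-b) = ≤-antisym (min-a _ walk-b) (min-b _ walk-a)

  record IsPotential (x : E) (φ : E → ℕ) : Set where
    field
      at-target : φ x ≡ 0
      lipschitz : ∀ {f g} → LAdj G f g → φ f ≤ suc (φ g)
      descent   : ∀ {e} → e ≢ x → ∃[ g ] (LAdj G e g × φ e ≡ suc (φ g))

  -- Breadth-first search in the line graph: a distance potential is the edge
  -- distance to its target (descending yields a walk, Lipschitz makes it shortest).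
  potential-is-distance : DecidableEquality E → ∀ {x φ} → IsPotential x φ →
                          ∀ e → EdgeDist G e x (φ e)
  potential-is-distance _≟_ {x} {φ} pot e = descend (φ e) e refl , shortest
    where
      open IsPotential pot

      descend : ∀ k e → φ e ≡ k → LWalk G e x k
      descend zero e φe≡0 with e ≟ x
      ... | yes refl = here
      ... | no e≢x with descent e≢x
      ...   | _ , _ , φe≡1+φg = contradiction (trans (sym φe≡1+φg) φe≡0) 1+n≢0
      descend (suc k) e φe≡1+k with e ≟ x
      ... | yes refl = contradiction (trans (sym at-target) φe≡1+k) 0≢1+n
      ... | no e≢x with descent e≢x
      ...   | g , adj , φe≡1+φg = step adj (descend k g (suc-injective (trans (sym φe≡1+φg) φe≡1+k)))

      shortest : ∀ {e} k → LWalk G e x k → φ e ≤ k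
      shortest zero here = ≤-reflexive at-target
      shortest (suc k) (step adj w) = ≤-trans (lipschitz adj) (s≤s (shortest k w))

  module Resolving (d : E → E → ℕ) (d-spec : ∀ x e → EdgeDist G e x (d x e)) where

    Balanced : E → E → E → E → Set
    Balanced x y e f = d x e + d y f ≡ d x f + d y e

    unbalanced-resolves : ∀ {x y e f} → ¬ Balanced x y e f → DoublyResolves G x y e f
    unbalanced-resolves {x} {y} {e} {f} unbalanced a b c c' xe ye xf yf eq =
      unbalanced (subst₂ _≡_
        (cong₂ _+_ (EdgeDist-unique xe (d-spec x e)) (EdgeDist-unique yf (d-spec y f)))
        (cong₂ _+_ (EdgeDist-unique xf (d-spec x f)) (EdgeDist-unique ye (d-spec y e)))
        (Equivalence.to (difference≡⇔cross-sum a b c c') eq))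

    balanced-unresolved : ∀ {x y e f} → Balanced x y e f → ¬ DoublyResolves G x y e f
    balanced-unresolved {x} {y} {e} {f} balanced resolves =
      resolves _ _ _ _ (d-spec x e) (d-spec y e) (d-spec x f) (d-spec y f)
        (Equivalence.from (difference≡⇔cross-sum (d x e) (d y e) (d x f) (d y f)) balanced)

    -- Pigeonhole: when every distance is at most B and more than 2B + 1
    -- edges are listed without repetition, the slots d x e + (B - d y e)
    -- collide, so some pair of distinct edges is balanced for x, y.
    module Pigeonhole (B : ℕ) (bounded : ∀ x e → d x e ≤ B)
                      {m : ℕ} (edge : Fin m → E) (edge-inj : Injective _≡_ _≡_ edge)
                      (many : suc (B + B) < m) where

      slot : E → E → E → ℕ
      slot x y e = d x e + (B ∸ d y e)

      slot< : ∀ x y e → slot x y e < suc (B + B)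
      slot< x y e = s≤s (+-mono-≤ (bounded x e) (m∸n≤m B (d y e)))

      balanced-pair : ∀ x y → ∃[ e ] ∃[ f ] (e ≢ f × Balanced x y e f)
      balanced-pair x y with Fin.pigeonhole many (λ i → fromℕ< (slot< x y (edge i)))
      ... | i , j , i<j , same-slot =
        edge i , edge j , (λ eq → Fin.<⇒≢ i<j (edge-inj eq)) ,
        offset-cancel (bounded y (edge i)) (bounded y (edge j))
          (Fin.fromℕ<-injective _ _ (slot< x y (edge i)) (slot< x y (edge j)) same-slot)

      two-edges-insufficient : ∀ x y D → (∀ {z} → z ∈ D → (z ≡ x) ⊎ (z ≡ y)) → ¬ IsEdgeDRS G D
      two-edges-insufficient x y D covered drs with balanced-pair x y
      ... | e , f , e≢f , balanced with drs e f e≢f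
      ... | u , v , u∈D , v∈D , resolves with covered u∈D | covered v∈D
      ... | inj₁ refl | inj₁ refl = balanced-unresolved (+-comm (d x e) (d x f)) resolves
      ... | inj₁ refl | inj₂ refl = balanced-unresolved balanced resolves
      ... | inj₂ refl | inj₁ refl = balanced-unresolved swapped resolves
        where
          swapped : Balanced y x e f
          swapped = trans (+-comm (d y e) (d x f)) (trans (sym balanced) (+-comm (d x e) (d y f)))
      ... | inj₂ refl | inj₂ refl = balanced-unresolved (+-comm (d y e) (d y f)) resolves

      three-≤-DRS : ∀ D → IsEdgeDRS G D → 3 ≤ length D
      three-≤-DRS [] drs = contradiction drs (two-edges-insufficient e₀ e₀ [] λ ())
        where
          e₀ : E
          e₀ = edge (fromℕ< (≤-trans (s≤s z≤n) many))
      three-≤-DRS (x ∷ []) drs = contradiction drs (two-edges-insufficient x x _ λ { (here refl) → inj₁ refl })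
      three-≤-DRS (x ∷ y ∷ []) drs = contradiction drs (two-edges-insufficient x y _ λ
        { (here refl) → inj₁ refl ; (there (here refl)) → inj₂ refl })
      three-≤-DRS (_ ∷ _ ∷ _ ∷ _) _ = s≤s (s≤s (s≤s z≤n))

data Succ (M : ℕ) : ℕ → ℕ → Set where
  inner : ∀ {k} → suc k < M → Succ M k (suc k)
  wrap  : ∀ {k} → suc k ≡ M → Succ M k 0

module _ {M : ℕ} where

  Succ-pred : ∀ {k j} → Succ M k (suc j) → k ≡ j
  Succ-pred (inner _) = refl

  Succ-origin : ∀ {k} → Succ M 0 k → pred k ≡ 0
  Succ-origin (inner _) = refl
  Succ-origin (wrap _)  = refl

cycle-dist : ℕ → ℕ → ℕ
cycle-dist M k = k ⊓ (M ∸ k)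

module _ {M : ℕ} where

  cycle-dist-low : ∀ {k} → k ≤ M ∸ k → cycle-dist M k ≡ k
  cycle-dist-low = m≤n⇒m⊓n≡m

  cycle-dist-high : ∀ {k} → M ∸ k ≤ k → cycle-dist M k ≡ M ∸ k
  cycle-dist-high = m≥n⇒m⊓n≡n

  cycle-dist-bound : ∀ {k} → k ≤ M → cycle-dist M k + cycle-dist M k ≤ M
  cycle-dist-bound {k} k≤M =
    ≤-trans (+-mono-≤ (m⊓n≤m k (M ∸ k)) (m⊓n≤n k (M ∸ k))) (≤-reflexive (m+[n∸m]≡n k≤M))

  cycle-dist-zero : ∀ {k} → k < M → cycle-dist M k ≡ 0 → k ≡ 0
  cycle-dist-zero {zero}  _   _  = refl
  cycle-dist-zero {suc k} k<M eq with M ∸ suc k | m<n⇒0<n∸m k<M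
  ... | suc _ | _ = contradiction eq λ ()

  cycle-dist-stepˡ : ∀ {k k'} → Succ M k k' → cycle-dist M k ≤ suc (cycle-dist M k')
  cycle-dist-stepˡ {k} (inner p) = begin
    k ⊓ (M ∸ k)                  ≡⟨ cong (k ⊓_) (∸-peel M k (<⇒≤ p)) ⟩
    k ⊓ suc (M ∸ suc k)          ≤⟨ ⊓-monoˡ-≤ _ (≤-trans (n≤1+n k) (n≤1+n (suc k))) ⟩
    suc (suc k ⊓ (M ∸ suc k))    ∎
    where open ≤-Reasoning
  cycle-dist-stepˡ {k} (wrap e) = ≤-trans (m⊓n≤n k (M ∸ k)) (≤-reflexive (last-gap e))

  cycle-dist-stepʳ : ∀ {k k'} → Succ M k k' → cycle-dist M k' ≤ suc (cycle-dist M k)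
  cycle-dist-stepʳ {k} (inner p) = begin
    suc k ⊓ (M ∸ suc k)            ≤⟨ ⊓-monoʳ-≤ (suc k) (≤-trans (n≤1+n _) (n≤1+n _)) ⟩
    suc k ⊓ suc (suc (M ∸ suc k))  ≡⟨ cong (λ t → suc (k ⊓ t)) (∸-peel M k (<⇒≤ p)) ⟨
    suc (k ⊓ (M ∸ k))              ∎
    where open ≤-Reasoning
  cycle-dist-stepʳ (wrap _) = z≤n

  cycle-dist-descent : ∀ {k k' m} → Succ M k k' → cycle-dist M k ≡ suc m →
                       cycle-dist M k' ≡ m ⊎ (∀ {k''} → Succ M k'' k → cycle-dist M k'' ≡ m)
  cycle-dist-descent {k} {_} {m} (inner p) eq with ≤-total k (M ∸ k)
  ... | inj₁ low = inj₂ λ s → trans (cong (cycle-dist M) (Succ-pred (subst (Succ M _) k≡1+m s)))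
                                    (cycle-dist-low m≤M∸m)
    where
      k≡1+m : k ≡ suc m
      k≡1+m = trans (sym (cycle-dist-low low)) eq
      m≤k : m ≤ k
      m≤k = ≤-trans (n≤1+n m) (≤-reflexive (sym k≡1+m))
      m≤M∸m : m ≤ M ∸ m
      m≤M∸m = ≤-trans m≤k (≤-trans low (∸-monoʳ-≤ M m≤k))
  ... | inj₂ high = inj₁ (trans (cycle-dist-high M∸1+k≤1+k) M∸1+k≡m)
    where
      M∸1+k≡m : M ∸ suc k ≡ m
      M∸1+k≡m = suc-injective (trans (sym (∸-peel M k (<⇒≤ p))) (trans (sym (cycle-dist-high high)) eq))
      M∸1+k≤1+k : M ∸ suc k ≤ suc k
      M∸1+k≤1+k = ≤-trans (∸-monoʳ-≤ M (n≤1+n k)) (≤-trans high (n≤1+n k))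
  cycle-dist-descent {k} {_} {m} (wrap e) eq = inj₁ (sym (n≤0⇒n≡0 (s≤s⁻¹ 1+m≤1)))
    where
      1+m≤1 : suc m ≤ 1
      1+m≤1 = ≤-trans (≤-reflexive (sym eq)) (≤-trans (m⊓n≤n k (M ∸ k)) (≤-reflexive (last-gap e)))

-- Distance to the edge {0, 1} of the M-cycle: contracting that edge leaves the
-- (M - 1)-cycle in which the point k becomes k - 1 and the edge becomes 0.
edge-dist : ℕ → ℕ → ℕ
edge-dist M k = cycle-dist (pred M) (pred k)

module _ {M : ℕ} where

  Succ-contract : ∀ {k k'} → Succ M k k' →
                  (pred k ≡ 0 × pred k' ≡ 0) ⊎ Succ (pred M) (pred k) (pred k')
  Succ-contract {zero}  (inner _)       = inj₁ (refl , refl)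
  Succ-contract {suc j} (inner (s≤s p)) = inj₂ (inner p)
  Succ-contract {zero}  (wrap _)        = inj₁ (refl , refl)
  Succ-contract {suc j} (wrap e)        = inj₂ (wrap (cong pred e))

  edge-dist-at-edge : ∀ k → pred k ≡ 0 → edge-dist M k ≡ 0
  edge-dist-at-edge _ eq = cong (cycle-dist (pred M)) eq

  edge-dist-stepˡ : ∀ {k k'} → Succ M k k' → edge-dist M k ≤ suc (edge-dist M k')
  edge-dist-stepˡ {k} s with Succ-contract s
  ... | inj₁ (k₀ , _) = ≤-trans (≤-reflexive (edge-dist-at-edge k k₀)) z≤n
  ... | inj₂ s′       = cycle-dist-stepˡ s′

  edge-dist-stepʳ : ∀ {k k'} → Succ M k k' → edge-dist M k' ≤ suc (edge-dist M k)
  edge-dist-stepʳ {k' = k'} s with Succ-contract s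
  ... | inj₁ (_ , k₀′) = ≤-trans (≤-reflexive (edge-dist-at-edge k' k₀′)) z≤n
  ... | inj₂ s′        = cycle-dist-stepʳ s′

  edge-dist-bound : ∀ {k} → k ≤ M → edge-dist M k + edge-dist M k ≤ M
  edge-dist-bound k≤M = ≤-trans (cycle-dist-bound (pred-mono-≤ k≤M)) pred[n]≤n

  edge-dist-zero : ∀ {k} → k < M → edge-dist M k ≡ 0 → k ≡ 0 ⊎ k ≡ 1
  edge-dist-zero {zero}  _         _  = inj₁ refl
  edge-dist-zero {suc j} (s≤s j<M) eq = inj₂ (cong suc (cycle-dist-zero j<M eq))

  edge-dist-descent : ∀ {k k' m} → Succ M k k' → edge-dist M k ≡ suc m →
                      edge-dist M k' ≡ m ⊎ (∀ {k''} → Succ M k'' k → edge-dist M k'' ≡ m)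
  edge-dist-descent {k} s eq with Succ-contract s
  ... | inj₁ (k₀ , _) = contradiction (trans (sym eq) (edge-dist-at-edge k k₀)) λ ()
  ... | inj₂ s′ with cycle-dist-descent s′ eq
  ...   | inj₁ next = inj₁ next
  ...   | inj₂ prev = inj₂ λ s″ → [ (λ (_ , k₀) → contradiction k₀ off-edge) , prev ]′ (Succ-contract s″)
    where
      off-edge : pred k ≢ 0
      off-edge k₀ = contradiction (trans (sym eq) (edge-dist-at-edge k k₀)) λ ()

  -- The nearer endpoint of the step k → k' (k ≠ 0) is one closer to the edge
  -- {0, 1} than k is to 0: this is the distance between two cycle edges.
  edge-dist-step-min : ∀ {k k'} → Succ M k k' → k ≢ 0 →
                       suc (edge-dist M k ⊓ edge-dist M k') ≡ cycle-dist M k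
  edge-dist-step-min {zero} _ k≢0 = contradiction refl k≢0
  edge-dist-step-min {suc j} (inner (s≤s {n = M′} p)) _ = begin
    suc ((j ⊓ (M′ ∸ j)) ⊓ (suc j ⊓ L))  ≡⟨ cong (λ t → suc ((j ⊓ t) ⊓ (suc j ⊓ L))) peel ⟩
    suc ((j ⊓ suc L) ⊓ (suc j ⊓ L))     ≡⟨ cong suc (⊓-interchange j (suc L) (suc j) L) ⟩
    suc ((j ⊓ suc j) ⊓ (suc L ⊓ L))     ≡⟨ cong₂ (λ u v → suc (u ⊓ v)) (m≤n⇒m⊓n≡m (n≤1+n j)) (m≥n⇒m⊓n≡n (n≤1+n L)) ⟩
    suc j ⊓ suc L                       ≡⟨ cong (suc j ⊓_) peel ⟨
    suc j ⊓ (M′ ∸ j)                    ∎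
    where
      open ≡-Reasoning
      L = M′ ∸ suc j
      peel : M′ ∸ j ≡ suc L
      peel = ∸-peel M′ j (<⇒≤ p)
  edge-dist-step-min {suc j} (wrap e) _ = begin
    suc (edge-dist M (suc j) ⊓ 0)  ≡⟨ cong suc (⊓-zeroʳ (edge-dist M (suc j))) ⟩
    1                              ≡⟨ cong suc (⊓-zeroʳ j) ⟨
    suc j ⊓ 1                      ≡⟨ cong (suc j ⊓_) (last-gap e) ⟨
    suc j ⊓ (M ∸ suc j)            ∎
    where open ≡-Reasoning

cycle-dist-first-half : ∀ {M k} → k + k ≤ M → cycle-dist M k ≡ k
cycle-dist-first-half {k = k} le = cycle-dist-low (m+n≤o⇒m≤o∸n k le)

cycle-dist-second-half : ∀ {M k} → M ≤ k + k → k ≤ M → cycle-dist M k + k ≡ M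
cycle-dist-second-half {M} {k} le k≤M =
  trans (cong (_+ k) (cycle-dist-high (m≤n+o⇒m∸n≤o M k le))) (m∸n+n≡m k≤M)


record CyclicProfile (M : ℕ) (g : ℕ → ℕ) : Set where
  field
    stepˡ   : ∀ {k k'} → Succ M k k' → g k ≤ suc (g k')
    stepʳ   : ∀ {k k'} → Succ M k k' → g k' ≤ suc (g k)
    descent : ∀ {k k' m} → Succ M k k' → g k ≡ suc m →
              g k' ≡ m ⊎ (∀ {k''} → Succ M k'' k → g k'' ≡ m)

cycle-dist-profile : ∀ M → CyclicProfile M (cycle-dist M)
cycle-dist-profile M = record
  { stepˡ = cycle-dist-stepˡ ; stepʳ = cycle-dist-stepʳ ; descent = cycle-dist-descent }

edge-dist-profile : ∀ M → CyclicProfile M (edge-dist M)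
edge-dist-profile M = record
  { stepˡ = edge-dist-stepˡ ; stepʳ = edge-dist-stepʳ ; descent = edge-dist-descent }

module _ (N : ℕ) .{{_ : NonZero N}} where

  %-absorbˡ : ∀ x y → ((x % N) + y) % N ≡ (x + y) % N
  %-absorbˡ x y = begin
    ((x % N) + y) % N              ≡⟨ %-distribˡ-+ (x % N) y N ⟩
    ((x % N % N) + (y % N)) % N    ≡⟨ cong (λ t → (t + (y % N)) % N) (m%n%n≡m%n x N) ⟩
    ((x % N) + (y % N)) % N        ≡⟨ %-distribˡ-+ x y N ⟨
    (x + y) % N                    ∎
    where open ≡-Reasoning

  %-absorbʳ : ∀ y x → (y + (x % N)) % N ≡ (y + x) % N
  %-absorbʳ y x = begin
    (y + (x % N)) % N  ≡⟨ cong (_% N) (+-comm y (x % N)) ⟩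
    ((x % N) + y) % N  ≡⟨ %-absorbˡ x y ⟩
    (x + y) % N        ≡⟨ cong (_% N) (+-comm x y) ⟩
    (y + x) % N        ∎
    where open ≡-Reasoning

  Succ-% : ∀ x → Succ N (x % N) (suc x % N)
  Succ-% x with m≤n⇒m<n∨m≡n (m%n<n x N)
  ... | inj₁ 1+r<N = subst (Succ N (x % N)) (trans (sym (m<n⇒m%n≡m 1+r<N)) (%-absorbʳ 1 x)) (inner 1+r<N)
  ... | inj₂ 1+r≡N = subst (Succ N (x % N)) wrapped (wrap 1+r≡N)
    where
      wrapped : 0 ≡ suc x % N
      wrapped = trans (sym (n%n≡0 N)) (trans (cong (_% N) (sym 1+r≡N)) (%-absorbʳ 1 x))

module CycleVertices (n : ℕ) where

  N : ℕ
  N = suc n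

  next : Fin N → Fin N
  next = nextMod

  toℕ-next : ∀ i → toℕ (next i) ≡ suc (toℕ i) % N
  toℕ-next i = Fin.toℕ-fromℕ< _

  prev : ∀ i → ∃[ j ] next j ≡ i
  prev i = fromℕ< (m%n<n (toℕ i + n) N) , Fin.toℕ-injective (begin
    toℕ (next (fromℕ< _))          ≡⟨ toℕ-next _ ⟩
    suc (toℕ (fromℕ< _)) % N       ≡⟨ cong (λ t → suc t % N) (Fin.toℕ-fromℕ< _) ⟩
    (1 + (toℕ i + n) % N) % N      ≡⟨ %-absorbʳ N 1 (toℕ i + n) ⟩
    suc (toℕ i + n) % N            ≡⟨ cong (_% N) (+-suc (toℕ i) n) ⟨
    (toℕ i + N) % N                ≡⟨ [m+n]%n≡m%n (toℕ i) N ⟩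
    toℕ i % N                      ≡⟨ m<n⇒m%n≡m (Fin.toℕ<n i) ⟩
    toℕ i                          ∎)
    where open ≡-Reasoning

  offset : Fin N → Fin N → ℕ
  offset i a = (toℕ i + (N ∸ toℕ a)) % N

  offset< : ∀ i a → offset i a < N
  offset< i a = m%n<n (toℕ i + (N ∸ toℕ a)) N

  offset-self : ∀ a → offset a a ≡ 0
  offset-self a = trans (cong (_% N) (m+[n∸m]≡n (<⇒≤ (Fin.toℕ<n a)))) (n%n≡0 N)

  offset-next : ∀ i a → Succ N (offset i a) (offset (next i) a)
  offset-next i a = subst (Succ N (offset i a)) shifted (Succ-% N (toℕ i + (N ∸ toℕ a)))
    where
      shifted : suc (toℕ i + (N ∸ toℕ a)) % N ≡ offset (next i) a
      shifted = trans (sym (%-absorbˡ N (suc (toℕ i)) (N ∸ toℕ a)))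
                      (cong (λ t → (t + (N ∸ toℕ a)) % N) (sym (toℕ-next i)))

  Wraps : ℕ → ℕ → ℕ → Set
  Wraps α t k = (k + α ≡ t) ⊎ (k + α ≡ t + N)

  offset-wraps : ∀ i a → Wraps (toℕ a) (toℕ i) (offset i a)
  offset-wraps i a = by-lap (N ≤? x)
    where
      open ≡-Reasoning
      t = toℕ i
      α = toℕ a
      x = t + (N ∸ α)

      x+α≡t+N : x + α ≡ t + N
      x+α≡t+N = trans (+-assoc t (N ∸ α) α) (cong (t +_) (m∸n+n≡m (<⇒≤ (Fin.toℕ<n a))))

      by-lap : Dec (N ≤ x) → Wraps α t (x % N)
      by-lap (no x≱N) = inj₂ (trans (cong (_+ α) (m<n⇒m%n≡m (≰⇒> x≱N))) x+α≡t+N)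
      by-lap (yes N≤x) = inj₁ (+-cancelʳ-≡ N _ _ (begin
        x % N + α + N    ≡⟨ cong (λ r → r + α + N) reduced ⟩
        x ∸ N + α + N    ≡⟨ xy∙z≈xz∙y (x ∸ N) α N ⟩
        x ∸ N + N + α    ≡⟨ cong (_+ α) (m∸n+n≡m N≤x) ⟩
        x + α            ≡⟨ x+α≡t+N ⟩
        t + N            ∎))
        where
          reduced : x % N ≡ x ∸ N
          reduced = trans (sym (m≤n⇒[n∸m]%m≡n%m N≤x))
                          (m<n⇒m%n≡m (m<n+o⇒m∸n<o x N (+-mono-<-≤ (Fin.toℕ<n i) (m∸n≤m N α))))

  lapped : ∀ {x s t} → t < N → x ≡ s + N → x ≢ t
  lapped {s = s} t<N e₁ e₂ = <⇒≱ t<N (≤-trans (m≤n+m N s) (≤-reflexive (trans (sym e₁) e₂)))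

  offset-injective : ∀ {i j} a → offset i a ≡ offset j a → i ≡ j
  offset-injective {i} {j} a eq
    with offset-wraps i a | subst (Wraps (toℕ a) (toℕ j)) (sym eq) (offset-wraps j a)
  ... | inj₁ e | inj₁ e′ = Fin.toℕ-injective (trans (sym e) e′)
  ... | inj₂ e | inj₂ e′ = Fin.toℕ-injective (+-cancelʳ-≡ N _ _ (trans (sym e) e′))
  ... | inj₁ e | inj₂ e′ = contradiction e (lapped (Fin.toℕ<n i) e′)
  ... | inj₂ e | inj₁ e′ = contradiction e′ (lapped (Fin.toℕ<n j) e)

  offset-origin : ∀ i → offset i Fin.zero ≡ toℕ i
  offset-origin i = trans ([m+n]%n≡m%n (toℕ i) N) (m<n⇒m%n≡m (Fin.toℕ<n i))

  wraps-low : ∀ {α t k} → Wraps α t k → α ≤ t → k < N → k + α ≡ t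
  wraps-low (inj₁ e) _ _ = e
  wraps-low {α} {t} {k} (inj₂ e) α≤t k<N =
    contradiction (≤-trans (+-mono-<-≤ k<N α≤t) (≤-reflexive (+-comm N t))) (<-irrefl e)

  wraps-high : ∀ {α t k} → Wraps α t k → t < α → k + α ≡ t + N
  wraps-high {α} {t} {k} (inj₁ e) t<α = contradiction (≤-trans t<α (m≤n+m α k)) (<-irrefl (sym e))
  wraps-high (inj₂ e) _ = e

module SunletDistances (n : ℕ) where
  open CycleVertices n

  Edge : Set
  Edge = SunletEdge N

  S : Graph
  S = Sunlet N

  _∈ᵥ_ : Fin N ⊎ Fin N → Edge → Set
  _∈ᵥ_ = _∈ₑ_ S

  cyc-injective : ∀ {i j} → cyc {N} i ≡ cyc j → i ≡ j
  cyc-injective refl = refl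

  pend-injective : ∀ {i j} → pend {N} i ≡ pend j → i ≡ j
  pend-injective refl = refl

  _≟E_ : DecidableEquality Edge
  cyc i  ≟E cyc j  = map′ (cong cyc) cyc-injective (i Fin.≟ j)
  cyc _  ≟E pend _ = no λ ()
  pend _ ≟E cyc _  = no λ ()
  pend i ≟E pend j = map′ (cong pend) pend-injective (i Fin.≟ j)

  shared-on-cycle : ∀ {f g v} → f ≢ g → v ∈ᵥ f → v ∈ᵥ g → ∃[ w ] v ≡ inj₁ w
  shared-on-cycle {cyc i}  _ (inj₁ refl) _ = i , refl
  shared-on-cycle {cyc i}  _ (inj₂ refl) _ = next i , refl
  shared-on-cycle {pend i} _ (inj₁ refl) _ = i , refl
  shared-on-cycle {pend i} {cyc _}  _ (inj₂ refl) (inj₁ ())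
  shared-on-cycle {pend i} {cyc _}  _ (inj₂ refl) (inj₂ ())
  shared-on-cycle {pend i} {pend _} _ (inj₂ refl) (inj₁ ())
  shared-on-cycle {pend i} {pend _} f≢g (inj₂ refl) (inj₂ refl) = contradiction refl f≢g

  record IsVertexPotential (x : Edge) (P : Fin N → ℕ) : Set where
    field
      stepˡ         : ∀ i → P i ≤ suc (P (next i))
      stepʳ         : ∀ i → P (next i) ≤ suc (P i)
      zero⇒endpoint : ∀ i → P i ≡ 0 → inj₁ i ∈ᵥ x
      endpoint⇒zero : ∀ i → inj₁ i ∈ᵥ x → P i ≡ 0
      descent       : ∀ i {m} → P i ≡ suc m → P (next i) ≡ m ⊎ ∃[ j ] (next j ≡ i × P j ≡ m)

  nearest : (Fin N → ℕ) → Edge → ℕ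
  nearest P (cyc i)  = P i ⊓ P (next i)
  nearest P (pend i) = P i

  nearest-attained : ∀ P e → ∃[ w ] (inj₁ w ∈ᵥ e × P w ≡ nearest P e)
  nearest-attained P (cyc i) with ⊓-sel (P i) (P (next i))
  ... | inj₁ eq = i , inj₁ refl , sym eq
  ... | inj₂ eq = next i , inj₂ refl , sym eq
  nearest-attained P (pend i) = i , inj₁ refl , refl

  nearest-≤ : ∀ P {w} e → inj₁ w ∈ᵥ e → nearest P e ≤ P w
  nearest-≤ P (cyc i)  (inj₁ refl) = m⊓n≤m _ _
  nearest-≤ P (cyc i)  (inj₂ refl) = m⊓n≤n _ _
  nearest-≤ P (pend i) (inj₁ refl) = ≤-refl

  lift : Edge → (Fin N → ℕ) → Edge → ℕ
  lift x P e with e ≟E x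
  ... | yes _ = 0
  ... | no  _ = suc (nearest P e)

  lift-at : ∀ x P → lift x P x ≡ 0
  lift-at x P with x ≟E x
  ... | yes _   = refl
  ... | no  x≢x = contradiction refl x≢x

  lift-off : ∀ {x} P {e} → e ≢ x → lift x P e ≡ suc (nearest P e)
  lift-off {x} P {e} e≢x with e ≟E x
  ... | yes e≡x = contradiction e≡x e≢x
  ... | no  _   = refl

  module _ {x : Edge} {P : Fin N → ℕ} (pot : IsVertexPotential x P) where
    open IsVertexPotential pot

    nearest-≥ : ∀ {w} e → inj₁ w ∈ᵥ e → P w ≤ suc (nearest P e)
    nearest-≥ (cyc i)  (inj₁ refl) = ⊓-glb (n≤1+n _) (stepˡ i)
    nearest-≥ (cyc i)  (inj₂ refl) = ⊓-glb (stepʳ i) (n≤1+n _)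
    nearest-≥ (pend i) (inj₁ refl) = n≤1+n _

    lift-lipschitz : ∀ {f g} → LAdj S f g → lift x P f ≤ suc (lift x P g)
    lift-lipschitz {f} {g} (f≢g , v , v∈f , v∈g) with shared-on-cycle f≢g v∈f v∈g
    ... | w , refl with f ≟E x | g ≟E x
    ... | yes _ | _        = z≤n
    ... | no _  | yes refl = s≤s (≤-trans (nearest-≤ P f v∈f) (≤-reflexive (endpoint⇒zero w v∈g)))
    ... | no _  | no _     = s≤s (≤-trans (nearest-≤ P f v∈f) (nearest-≥ g v∈g))

    descent-via : ∀ {e w m} g → e ≢ x → inj₁ w ∈ᵥ e → inj₁ w ∈ᵥ g →
                  nearest P e ≡ suc m → nearest P g ≡ m →
                  LAdj S e g × lift x P e ≡ suc (lift x P g)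
    descent-via {e} {w} {m} g e≢x w∈e w∈g near-e near-g =
      (e≢g , inj₁ w , w∈e , w∈g) ,
      trans (lift-off P e≢x) (cong suc (trans near-e (trans (cong suc (sym near-g)) (sym (lift-off P g≢x)))))
      where
        e≢g : e ≢ g
        e≢g refl = 1+n≢n (trans (sym near-e) near-g)
        g≢x : g ≢ x
        g≢x refl = contradiction (≤-trans (≤-reflexive (sym near-e))
                                   (≤-trans (nearest-≤ P e w∈e) (≤-reflexive (endpoint⇒zero w w∈g)))) λ ()

    -- Descending from e ≠ x: into x itself when the nearest endpoint of e
    -- lies on x, otherwise into the cycle edge towards a smaller potential.
    lift-descent : ∀ {e} → e ≢ x → ∃[ g ] (LAdj S e g × lift x P e ≡ suc (lift x P g))
    lift-descent {e} e≢x with nearest-attained P e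
    ... | w , w∈e , Pw≡near with P w in Pw
    ... | zero  = x , (e≢x , inj₁ w , w∈e , zero⇒endpoint w Pw) ,
                  trans (lift-off P e≢x) (cong suc (trans (sym Pw≡near) (sym (lift-at x P))))
    ... | suc m with descent w Pw
    ...   | inj₁ P[next]≡m = cyc w , descent-via (cyc w) e≢x w∈e (inj₁ refl) (sym Pw≡near)
                               (trans (cong₂ _⊓_ Pw P[next]≡m) (m≥n⇒m⊓n≡n (n≤1+n m)))
    ...   | inj₂ (j , refl , Pj≡m) = cyc j , descent-via (cyc j) e≢x w∈e (inj₂ refl) (sym Pw≡near)
                               (trans (cong₂ _⊓_ Pj≡m Pw) (m≤n⇒m⊓n≡m (n≤1+n m)))

    lift-potential : IsPotential S x (lift x P)
    lift-potential = record
      { at-target = lift-at x P ; lipschitz = lift-lipschitz ; descent = lift-descent }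

  lift-bound : ∀ x P → (∀ i → P i + P i ≤ N) → ∀ e → lift x P e + lift x P e ≤ 2 + N
  lift-bound x P P-bound e with e ≟E x
  ... | yes _ = z≤n
  ... | no  _ with nearest-attained P e
  ...   | w , _ , Pw≡near =
    s≤s (≤-trans (≤-reflexive (+-suc p p)) (s≤s (subst (λ t → t + t ≤ N) Pw≡near (P-bound w))))
    where p = nearest P e

  offset-potential : ∀ {g} a x → CyclicProfile N g →
                     (∀ i → g (offset i a) ≡ 0 → inj₁ i ∈ᵥ x) →
                     (∀ i → inj₁ i ∈ᵥ x → g (offset i a) ≡ 0) →
                     IsVertexPotential x (λ i → g (offset i a))
  offset-potential {g} a x profile zero⇒endpoint endpoint⇒zero = record
    { stepˡ = λ i → stepˡ (offset-next i a)
    ; stepʳ = λ i → stepʳ (offset-next i a)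
    ; zero⇒endpoint = zero⇒endpoint
    ; endpoint⇒zero = endpoint⇒zero
    ; descent = vertex-descent
    }
    where
      open CyclicProfile profile
      vertex-descent : ∀ i {m} → g (offset i a) ≡ suc m →
                       g (offset (next i) a) ≡ m ⊎ ∃[ j ] (next j ≡ i × g (offset j a) ≡ m)
      vertex-descent i eq with descent (offset-next i a) eq | prev i
      ... | inj₁ forward  | _        = inj₁ forward
      ... | inj₂ backward | j , refl = inj₂ (j , refl , backward (offset-next j a))

  pendant-potential : ∀ a → IsVertexPotential (pend a) (λ i → cycle-dist N (offset i a))
  pendant-potential a = offset-potential a (pend a) (cycle-dist-profile N) zero⇒a a⇒zero
    where
      zero⇒a : ∀ i → cycle-dist N (offset i a) ≡ 0 → inj₁ i ∈ᵥ pend a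
      zero⇒a i eq = inj₁ (cong inj₁ (offset-injective a
                      (trans (cycle-dist-zero (offset< i a) eq) (sym (offset-self a)))))
      a⇒zero : ∀ i → inj₁ i ∈ᵥ pend a → cycle-dist N (offset i a) ≡ 0
      a⇒zero i (inj₁ refl) = cong (cycle-dist N) (offset-self a)

  cycle-potential : ∀ a → IsVertexPotential (cyc a) (λ i → edge-dist N (offset i a))
  cycle-potential a = offset-potential a (cyc a) (edge-dist-profile N) zero⇒ends ends⇒zero
    where
      at-a : ∀ {i} → offset i a ≡ 0 → i ≡ a
      at-a eq = offset-injective a (trans eq (sym (offset-self a)))
      zero⇒ends : ∀ i → edge-dist N (offset i a) ≡ 0 → inj₁ i ∈ᵥ cyc a
      zero⇒ends i eq with edge-dist-zero (offset< i a) eq | prev i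
      ... | inj₁ off≡0 | _        = inj₁ (cong inj₁ (at-a off≡0))
      ... | inj₂ off≡1 | j , refl =
        inj₂ (cong (inj₁ ∘ next) (at-a (Succ-pred (subst (Succ N _) off≡1 (offset-next j a)))))
      ends⇒zero : ∀ i → inj₁ i ∈ᵥ cyc a → edge-dist N (offset i a) ≡ 0
      ends⇒zero i (inj₁ refl) = cong (edge-dist N) (offset-self a)
      ends⇒zero i (inj₂ refl) = edge-dist-at-edge {N} (offset (next a) a)
        (Succ-origin (subst (λ k → Succ N k (offset (next a) a)) (offset-self a) (offset-next a a)))

  dist : Edge → Edge → ℕ
  dist (pend a) = lift (pend a) (λ i → cycle-dist N (offset i a))
  dist (cyc a)  = lift (cyc a)  (λ i → edge-dist N (offset i a))

  dist-spec : ∀ x e → EdgeDist S e x (dist x e)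
  dist-spec (pend a) = potential-is-distance S _≟E_ (lift-potential (pendant-potential a))
  dist-spec (cyc a)  = potential-is-distance S _≟E_ (lift-potential (cycle-potential a))

  dist-bound : ∀ x e → dist x e + dist x e ≤ 2 + N
  dist-bound (pend a) = lift-bound (pend a) _ λ i → cycle-dist-bound (<⇒≤ (offset< i a))
  dist-bound (cyc a)  = lift-bound (cyc a)  _ λ i → edge-dist-bound (<⇒≤ (offset< i a))

module LowerBound (n : ℕ) where
  open CycleVertices n
  open SunletDistances n

  edge : Fin (N + N) → Edge
  edge i = [ cyc , pend ]′ (splitAt N i)

  edge-injective : ∀ {i j} → edge i ≡ edge j → i ≡ j
  edge-injective {i} {j} eq = begin
    i                      ≡⟨ Fin.join-splitAt N N i ⟨
    join N N (splitAt N i) ≡⟨ cong (join N N) (split-eq (splitAt N i) (splitAt N j) eq) ⟩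
    join N N (splitAt N j) ≡⟨ Fin.join-splitAt N N j ⟩
    j                      ∎
    where
      open ≡-Reasoning
      split-eq : ∀ (s s' : Fin N ⊎ Fin N) → [ cyc , pend ]′ s ≡ [ cyc , pend ]′ s' → s ≡ s'
      split-eq (inj₁ _) (inj₁ _) refl = refl
      split-eq (inj₂ _) (inj₂ _) refl = refl
      split-eq (inj₁ _) (inj₂ _) ()
      split-eq (inj₂ _) (inj₁ _) ()

  dist<N : 4 ≤ N → ∀ x e → dist x e ≤ n
  dist<N 4≤N x e = s≤s⁻¹ (half-mono-≤ (begin
    suc d + suc d    ≡⟨ cong suc (+-suc d d) ⟩
    2 + (d + d)      ≤⟨ +-monoʳ-≤ 2 (dist-bound x e) ⟩
    4 + N            ≤⟨ +-monoˡ-≤ N 4≤N ⟩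
    N + N            ∎))
    where
      open ≤-Reasoning
      d = dist x e

  three-≤-DRS : 4 ≤ N → ∀ D → IsEdgeDRS S D → 3 ≤ length D
  three-≤-DRS 4≤N = Resolving.Pigeonhole.three-≤-DRS S dist dist-spec n (dist<N 4≤N) edge edge-injective
    (s≤s (≤-reflexive (sym (+-suc n n))))


module UpperBound (n h : ℕ) (halves : suc n ≡ h + h ⊎ suc (suc n) ≡ h + h) (4≤N : 4 ≤ suc n) where
  open CycleVertices n
  open SunletDistances n

  N≤2h : N ≤ h + h
  N≤2h = [ ≤-reflexive , (λ e → ≤-trans (n≤1+n N) (≤-reflexive e)) ]′ halves

  2h≤1+N : h + h ≤ suc N
  2h≤1+N = [ (λ e → ≤-trans (≤-reflexive (sym e)) (n≤1+n N)) , ≤-reflexive ∘ sym ]′ halves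

  2≤h : 2 ≤ h
  2≤h = half-mono-≤ (≤-trans 4≤N N≤2h)

  h<N : h < N
  h<N = half-mono-≤ (begin
    suc h + suc h      ≡⟨ cong suc (+-suc h h) ⟩
    suc (suc (h + h))  ≤⟨ s≤s (s≤s 2h≤1+N) ⟩
    3 + N              ≤⟨ +-monoˡ-≤ N (≤-trans (n≤1+n 3) 4≤N) ⟩
    N + N              ∎)
    where open ≤-Reasoning

  -- Distances from a cycle edge to the cycle edge, resp. the pendant edge,
  -- whose cycle vertex lies at offset k (see dist).
  q : ℕ → ℕ
  q = cycle-dist N

  p : ℕ → ℕ
  p k = suc (edge-dist N k)

  -- How an edge sees the resolving edges c₀, c₁, c_h: the differences of
  -- its distances d₀, d₁, d_h to them single out the parameter c.
  data Signature (d₀ d₁ dₕ c : ℕ) : Set where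
    nearer-c₁ : d₁ + 1 ≡ d₀ → dₕ + c ≡ d₀ + h + 1 → Signature d₀ d₁ dₕ c
    nearer-c₀ : d₀ + 1 ≡ d₁ → d₀ + c ≡ dₕ + h + N + 1 → Signature d₀ d₁ dₕ c
    tie-low   : d₀ ≡ d₁ → dₕ + 1 ≡ d₀ + h → c ≡ 2 → Signature d₀ d₁ dₕ c
    tie-high  : d₀ ≡ d₁ → dₕ + h ≡ d₀ + 1 → c ≡ N + 2 → Signature d₀ d₁ dₕ c

  nearer-c₁-cyc : ∀ {d₀ d₁ dₕ t} → d₁ + 1 ≡ d₀ → d₀ ≡ t → dₕ + t ≡ h →
                  Signature d₀ d₁ dₕ (suc (t + t))
  nearer-c₁-cyc {d₀} {d₁} {dₕ} {t} e₁ refl eₕ = nearer-c₁ e₁ (begin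
    dₕ + suc (t + t)  ≡⟨ solve (dₕ ∷ t ∷ []) ⟩
    dₕ + t + t + 1    ≡⟨ cong (λ x → x + t + 1) eₕ ⟩
    h + t + 1         ≡⟨ cong (_+ 1) (+-comm h t) ⟩
    t + h + 1         ∎)
    where open ≡-Reasoning

  nearer-c₁-pend : ∀ {d₀ d₁ dₕ t} → d₁ + 1 ≡ d₀ → d₀ ≡ t → dₕ + t ≡ h + 1 →
                   Signature d₀ d₁ dₕ (t + t)
  nearer-c₁-pend {d₀} {d₁} {dₕ} {t} e₁ refl eₕ = nearer-c₁ e₁ (begin
    dₕ + (t + t)  ≡⟨ +-assoc dₕ t t ⟨
    dₕ + t + t    ≡⟨ cong (_+ t) eₕ ⟩
    h + 1 + t     ≡⟨ solve (h ∷ t ∷ []) ⟩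
    t + h + 1     ∎)
    where open ≡-Reasoning

  nearer-c₀-cyc : ∀ {d₀ d₁ dₕ T} → d₀ + 1 ≡ d₁ → d₀ + T ≡ N → dₕ + h ≡ T →
                  Signature d₀ d₁ dₕ (suc (T + T))
  nearer-c₀-cyc {d₀} {d₁} {dₕ} {T} e₁ e₀ eₕ = nearer-c₀ e₁ (begin
    d₀ + suc (T + T)   ≡⟨ solve (d₀ ∷ T ∷ []) ⟩
    d₀ + T + T + 1     ≡⟨ cong (λ x → x + T + 1) e₀ ⟩
    N + T + 1          ≡⟨ cong (_+ 1) (+-comm N T) ⟩
    T + N + 1          ≡⟨ cong (λ x → x + N + 1) eₕ ⟨
    dₕ + h + N + 1     ∎)
    where open ≡-Reasoning

  nearer-c₀-pend : ∀ {d₀ d₁ dₕ T} → d₀ + 1 ≡ d₁ → d₀ + T ≡ suc N → dₕ + h ≡ T →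
                   Signature d₀ d₁ dₕ (T + T)
  nearer-c₀-pend {d₀} {d₁} {dₕ} {T} e₁ e₀ eₕ = nearer-c₀ e₁ (begin
    d₀ + (T + T)   ≡⟨ +-assoc d₀ T T ⟨
    d₀ + T + T     ≡⟨ cong (_+ T) e₀ ⟩
    suc N + T      ≡⟨ +-comm (suc N) T ⟩
    T + suc N      ≡⟨ +-suc T N ⟩
    suc (T + N)    ≡⟨ +-comm 1 (T + N) ⟩
    T + N + 1      ≡⟨ cong (λ x → x + N + 1) eₕ ⟨
    dₕ + h + N + 1 ∎)
    where open ≡-Reasoning

  q-first : ∀ {k} → k + k ≤ N → q k ≡ k
  q-first = cycle-dist-first-half

  q-second : ∀ {k} → N ≤ k + k → k ≤ N → q k + k ≡ N
  q-second = cycle-dist-second-half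

  p-first : ∀ {k} → 1 ≤ k → k + k ≤ suc N → p k ≡ k
  p-first {suc j} _ le =
    cong suc (cycle-dist-first-half (s≤s⁻¹ (≤-trans (≤-reflexive (sym (+-suc j j))) (s≤s⁻¹ le))))

  p-second : ∀ {k} → suc N ≤ k + k → k ≤ N → p k + k ≡ suc N
  p-second {suc j} le k≤N = cong suc (trans (+-suc _ j) (cong suc
    (cycle-dist-second-half (s≤s⁻¹ (≤-trans (s≤s⁻¹ le) (≤-reflexive (+-suc j j)))) (s≤s⁻¹ k≤N))))

  at-h : ∀ {t kₕ} → t + t ≤ suc N → kₕ + h ≡ t → kₕ ≡ 0 × t ≡ h
  at-h {t} {kₕ} le eₕ = kₕ≡0 , trans (sym eₕ) (cong (_+ h) kₕ≡0)
    where
      t≤h : t ≤ h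
      t≤h = half-mono-≤′ (≤-trans le (s≤s N≤2h))
      kₕ≡0 : kₕ ≡ 0
      kₕ≡0 = n≤0⇒n≡0 (+-cancelʳ-≤ h kₕ 0 (≤-trans (≤-reflexive eₕ) t≤h))

  ahead : ∀ {t kₕ} → 1 ≤ t → kₕ + h ≡ t + N → t + N ≤ kₕ + kₕ
  ahead {t} {kₕ} 1≤t eₕ = complement-second kₕ h eₕ (≤-trans 2h≤1+N (+-monoˡ-≤ N 1≤t))

  behind : ∀ {t kₕ} → kₕ + h ≡ t → t < N → kₕ + kₕ ≤ N
  behind {t} {kₕ} eₕ t<N = ≤-trans (complement-first kₕ h eₕ (≤-trans (<⇒≤ t<N) N≤2h)) (<⇒≤ t<N)

  cyc-origin : ∀ {k₁ kₕ} → k₁ + 1 ≡ N → kₕ + h ≡ N → Signature (q 0) (q k₁) (q kₕ) (suc (N + N))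
  cyc-origin {k₁} {kₕ} e₁ eₕ =
    nearer-c₀-cyc (shift-one {x = 0} refl (q-second N≤2k₁ (≤-by 1 e₁)) e₁) refl
                  (trans (cong (_+ h) (q-first (complement-first kₕ h eₕ N≤2h))) eₕ)
    where
      1≤k₁ : 1 ≤ k₁
      1≤k₁ = +-cancelʳ-≤ 1 1 k₁ (≤-trans (≤-trans (s≤s (s≤s z≤n)) 4≤N) (≤-reflexive (sym e₁)))
      N≤2k₁ : N ≤ k₁ + k₁
      N≤2k₁ = ≤-trans (≤-reflexive (sym e₁)) (+-monoʳ-≤ k₁ 1≤k₁)

  cyc-first-half : ∀ {t k₁ kₕ} → 1 ≤ t → t + t ≤ N → k₁ + 1 ≡ t → Wraps h t kₕ → kₕ < N →
                   Signature (q t) (q k₁) (q kₕ) (suc (t + t))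
  cyc-first-half {t} {k₁} {kₕ} 1≤t le e₁ eₕ kₕ<N =
    nearer-c₁-cyc (trans (cong (_+ 1) q[k₁]≡k₁) (trans e₁ (sym q[t]≡t))) q[t]≡t (dₕ eₕ)
    where
      open ≡-Reasoning
      q[t]≡t : q t ≡ t
      q[t]≡t = q-first le
      q[k₁]≡k₁ : q k₁ ≡ k₁
      q[k₁]≡k₁ = q-first (≤-trans (+-mono-≤ (≤-by 1 e₁) (≤-by 1 e₁)) le)
      dₕ : Wraps h t kₕ → q kₕ + t ≡ h
      dₕ (inj₂ ahead-eq) = +-cancelʳ-≡ (kₕ + h) _ _ (begin
        q kₕ + t + (kₕ + h)   ≡⟨ interchange (q kₕ) t kₕ h ⟩
        q kₕ + kₕ + (t + h)   ≡⟨ cong (_+ (t + h)) (q-second (m+n≤o⇒n≤o t (ahead 1≤t ahead-eq)) (<⇒≤ kₕ<N)) ⟩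
        N + (t + h)           ≡⟨ x∙yz≈z∙yx N t h ⟩
        h + (t + N)           ≡⟨ cong (h +_) ahead-eq ⟨
        h + (kₕ + h)          ∎)
      dₕ (inj₁ behind-eq) with at-h (≤-trans le (n≤1+n N)) behind-eq
      ... | refl , t≡h = t≡h

  cyc-middle : ∀ {t k₁ kₕ} → t + t ≡ suc N → t < N → k₁ + 1 ≡ t → kₕ + h ≡ t →
               Signature (q t) (q k₁) (q kₕ) (suc (t + t))
  cyc-middle {t} {k₁} {kₕ} tt t<N e₁ eₕ = tie-high q[t]≡q[k₁] dₕ (trans (cong suc tt) (+-comm 2 N))
    where
      t≡h : t ≡ h
      t≡h = [ (λ even → contradiction (trans tt (cong suc even)) (double≢odd t h))
            , (λ odd → half-injective (trans tt odd)) ]′ halves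
      k₁+t≡N : k₁ + t ≡ N
      k₁+t≡N = suc-injective (trans (sym (trans (+-assoc k₁ 1 t) (+-suc k₁ t))) (trans (cong (_+ t) e₁) tt))
      q[k₁]≡k₁ : q k₁ ≡ k₁
      q[k₁]≡k₁ = q-first (≤-trans (+-monoʳ-≤ k₁ (≤-by 1 e₁)) (≤-reflexive k₁+t≡N))
      q[t]≡q[k₁] : q t ≡ q k₁
      q[t]≡q[k₁] = +-cancelʳ-≡ t _ _ (trans (q-second (≤-trans (n≤1+n N) (≤-reflexive (sym tt))) (<⇒≤ t<N))
                                    (trans (sym k₁+t≡N) (cong (_+ t) (sym q[k₁]≡k₁))))
      kₕ≡0 : kₕ ≡ 0
      kₕ≡0 = +-cancelʳ-≡ h kₕ 0 (trans eₕ t≡h)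
      dₕ : q kₕ + h ≡ q t + 1
      dₕ = begin
        q kₕ + h   ≡⟨ cong (λ k → q k + h) kₕ≡0 ⟩
        h          ≡⟨ trans (sym t≡h) (sym e₁) ⟩
        k₁ + 1     ≡⟨ cong (_+ 1) (trans (sym q[k₁]≡k₁) (sym q[t]≡q[k₁])) ⟩
        q t + 1    ∎
        where open ≡-Reasoning

  cyc-second-half : ∀ {t k₁ kₕ} → suc (suc N) ≤ t + t → t < N → k₁ + 1 ≡ t → kₕ + h ≡ t →
                    Signature (q t) (q k₁) (q kₕ) (suc (t + t))
  cyc-second-half {t} {k₁} {kₕ} le t<N e₁ eₕ =
    nearer-c₀-cyc (shift-one q[t]+t≡N (q-second N≤2k₁ (≤-trans (≤-by 1 e₁) (<⇒≤ t<N))) e₁) q[t]+t≡N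
                  (trans (cong (_+ h) (q-first (behind eₕ t<N))) eₕ)
    where
      q[t]+t≡N : q t + t ≡ N
      q[t]+t≡N = q-second (≤-trans (≤-trans (n≤1+n N) (n≤1+n _)) le) (<⇒≤ t<N)
      N≤2k₁ : N ≤ k₁ + k₁
      N≤2k₁ = +-cancelʳ-≤ 2 N (k₁ + k₁) (begin
        N + 2                  ≡⟨ +-comm N 2 ⟩
        suc (suc N)            ≤⟨ le ⟩
        t + t                  ≡⟨ cong₂ _+_ e₁ e₁ ⟨
        k₁ + 1 + (k₁ + 1)      ≡⟨ solve (k₁ ∷ []) ⟩
        k₁ + k₁ + 2            ∎)
        where open ≤-Reasoning

  pend-origin : ∀ {k₁ kₕ} → k₁ + 1 ≡ N → kₕ + h ≡ N → Signature (p 0) (p k₁) (p kₕ) (N + N)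
  pend-origin {k₁} {kₕ} e₁ eₕ =
    nearer-c₀-pend (shift-one {x = 1} refl (p-second 1+N≤2k₁ (≤-by 1 e₁)) e₁) refl
                   (trans (cong (_+ h) (p-first 1≤kₕ (≤-trans (complement-first kₕ h eₕ N≤2h) (n≤1+n N)))) eₕ)
    where
      open ≤-Reasoning
      1+N≤2k₁ : suc N ≤ k₁ + k₁
      1+N≤2k₁ = begin
        suc N         ≡⟨ cong suc (trans (sym e₁) (+-comm k₁ 1)) ⟩
        2 + k₁        ≤⟨ +-monoˡ-≤ k₁ (+-cancelʳ-≤ 1 2 k₁ (≤-trans (≤-trans (n≤1+n 3) 4≤N) (≤-reflexive (sym e₁)))) ⟩
        k₁ + k₁       ∎
      1≤kₕ : 1 ≤ kₕ
      1≤kₕ = n≢0⇒n>0 λ { refl → <-irrefl eₕ h<N }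

  pend-one : ∀ {k₁ kₕ} → k₁ + 1 ≡ 1 → kₕ + h ≡ 1 + N → kₕ < N → Signature (p 1) (p k₁) (p kₕ) 2
  pend-one {k₁} {kₕ} e₁ eₕ kₕ<N =
    tie-low (cong p (sym (+-cancelʳ-≡ 1 k₁ 0 e₁))) (trans (cong (_+ 1) p[kₕ]≡h) (+-comm h 1)) refl
    where
      p[kₕ]≡h : p kₕ ≡ h
      p[kₕ]≡h = +-cancelʳ-≡ kₕ _ _ (trans (p-second (complement-second kₕ h eₕ 2h≤1+N) (<⇒≤ kₕ<N))
                                         (trans (sym eₕ) (+-comm kₕ h)))

  pend-first-half : ∀ {t k₁ kₕ} → 2 ≤ t → t + t ≤ suc N → k₁ + 1 ≡ t → Wraps h t kₕ → kₕ < N →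
                    Signature (p t) (p k₁) (p kₕ) (t + t)
  pend-first-half {t} {k₁} {kₕ} 2≤t le e₁ eₕ kₕ<N =
    nearer-c₁-pend (trans (cong (_+ 1) p[k₁]≡k₁) (trans e₁ (sym p[t]≡t))) p[t]≡t (dₕ eₕ)
    where
      open ≡-Reasoning
      1≤t : 1 ≤ t
      1≤t = ≤-trans (s≤s z≤n) 2≤t
      p[t]≡t : p t ≡ t
      p[t]≡t = p-first 1≤t le
      p[k₁]≡k₁ : p k₁ ≡ k₁
      p[k₁]≡k₁ = p-first (+-cancelʳ-≤ 1 1 k₁ (≤-trans 2≤t (≤-reflexive (sym e₁))))
                         (≤-trans (+-mono-≤ (≤-by 1 e₁) (≤-by 1 e₁)) le)
      dₕ : Wraps h t kₕ → p kₕ + t ≡ h + 1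
      dₕ (inj₂ ahead-eq) = +-cancelʳ-≡ (kₕ + h) _ _ (begin
        p kₕ + t + (kₕ + h)   ≡⟨ interchange (p kₕ) t kₕ h ⟩
        p kₕ + kₕ + (t + h)   ≡⟨ cong (_+ (t + h)) (p-second (≤-trans (+-monoˡ-≤ N 1≤t) (ahead 1≤t ahead-eq)) (<⇒≤ kₕ<N)) ⟩
        suc (N + (t + h))     ≡⟨ cong suc (x∙yz≈z∙yx N t h) ⟩
        suc (h + (t + N))     ≡⟨ cong (_+ (t + N)) (+-comm 1 h) ⟩
        h + 1 + (t + N)       ≡⟨ cong (h + 1 +_) ahead-eq ⟨
        h + 1 + (kₕ + h)      ∎)
      dₕ (inj₁ behind-eq) with at-h le behind-eq
      ... | refl , t≡h = trans (cong suc t≡h) (+-comm 1 h)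

  pend-middle : ∀ {t k₁ kₕ} → t + t ≡ suc (suc N) → t < N → k₁ + 1 ≡ t → kₕ + h ≡ t →
                Signature (p t) (p k₁) (p kₕ) (t + t)
  pend-middle {t} {k₁} {kₕ} tt t<N e₁ eₕ = tie-high (trans p[t]≡h (sym p[k₁]≡h)) dₕ (trans tt (+-comm 2 N))
    where
      N≡2h : N ≡ h + h
      N≡2h = [ (λ e → e) , (λ e → contradiction (trans tt (cong suc e)) (double≢odd t h)) ]′ halves
      t≡1+h : t ≡ suc h
      t≡1+h = half-injective (trans tt (trans (cong (λ m → suc (suc m)) N≡2h) (cong suc (sym (+-suc h h)))))
      k₁≡h : k₁ ≡ h
      k₁≡h = +-cancelʳ-≡ 1 k₁ h (trans e₁ (trans t≡1+h (+-comm 1 h)))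
      p[k₁]≡h : p k₁ ≡ h
      p[k₁]≡h = trans (cong p k₁≡h) (p-first (≤-trans (s≤s z≤n) 2≤h) (≤-trans (≤-reflexive (sym N≡2h)) (n≤1+n N)))
      p[t]≡h : p t ≡ h
      p[t]≡h = +-cancelʳ-≡ t _ _ (trans (p-second (≤-trans (n≤1+n _) (≤-reflexive (sym tt))) (<⇒≤ t<N))
                                 (trans (cong suc N≡2h) (trans (sym (+-suc h h)) (cong (h +_) (sym t≡1+h)))))
      dₕ : p kₕ + h ≡ p t + 1
      dₕ = trans (cong (λ k → p k + h) (+-cancelʳ-≡ h kₕ 1 (trans eₕ t≡1+h)))
                 (trans (+-comm 1 h) (cong (_+ 1) (sym p[t]≡h)))

  pend-second-half : ∀ {t k₁ kₕ} → suc (suc (suc N)) ≤ t + t → t < N → k₁ + 1 ≡ t → kₕ + h ≡ t →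
                     Signature (p t) (p k₁) (p kₕ) (t + t)
  pend-second-half {t} {k₁} {kₕ} le t<N e₁ eₕ =
    nearer-c₀-pend (shift-one p[t]+t≡1+N (p-second 1+N≤2k₁ (≤-trans (≤-by 1 e₁) (<⇒≤ t<N))) e₁) p[t]+t≡1+N
                   (trans (cong (_+ h) (p-first 1≤kₕ (≤-trans (behind eₕ t<N) (n≤1+n N)))) eₕ)
    where
      p[t]+t≡1+N : p t + t ≡ suc N
      p[t]+t≡1+N = p-second (≤-trans (≤-trans (n≤1+n _) (n≤1+n _)) le) (<⇒≤ t<N)
      1+N≤2k₁ : suc N ≤ k₁ + k₁
      1+N≤2k₁ = +-cancelʳ-≤ 2 (suc N) (k₁ + k₁) (begin
        suc N + 2              ≡⟨ +-comm (suc N) 2 ⟩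
        suc (suc (suc N))      ≤⟨ le ⟩
        t + t                  ≡⟨ cong₂ _+_ e₁ e₁ ⟨
        k₁ + 1 + (k₁ + 1)      ≡⟨ solve (k₁ ∷ []) ⟩
        k₁ + k₁ + 2            ∎)
        where open ≤-Reasoning
      1≤kₕ : 1 ≤ kₕ
      1≤kₕ = n≢0⇒n>0 λ { refl → contradiction (≤-trans le (≤-trans (≤-reflexive (cong₂ _+_ (sym eₕ) (sym eₕ))) 2h≤1+N))
                                               (λ ineq → 1+n≰n (≤-trans (n≤1+n _) ineq)) }

  slope : ∀ {d₀ d₁ dₕ c} → Signature d₀ d₁ dₕ c → ℕ
  slope (nearer-c₁ _ _)  = 2
  slope (nearer-c₀ _ _)  = 0
  slope (tie-low _ _ _)  = 1
  slope (tie-high _ _ _) = 1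

  slope-spec : ∀ {d₀ d₁ dₕ c} (σ : Signature d₀ d₁ dₕ c) → d₁ + slope σ ≡ d₀ + 1
  slope-spec {d₁ = d₁} (nearer-c₁ e _) = trans (sym (+-assoc d₁ 1 1)) (cong (_+ 1) e)
  slope-spec {d₁ = d₁} (nearer-c₀ e _) = trans (+-identityʳ d₁) (sym e)
  slope-spec (tie-low e _ _)  = cong (_+ 1) (sym e)
  slope-spec (tie-high e _ _) = cong (_+ 1) (sym e)

  slopes-agree : ∀ {d₀ d₁ dₕ c d₀′ d₁′ dₕ′ c′}
                 (σ : Signature d₀ d₁ dₕ c) (σ′ : Signature d₀′ d₁′ dₕ′ c′) →
                 d₁ + d₀′ ≡ d₁′ + d₀ → slope σ ≡ slope σ′
  slopes-agree {d₀} {d₁} {_} {_} {d₀′} {d₁′} σ σ′ E₁ = +-cancelˡ-≡ (d₁ + d₀′) _ _ (begin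
    d₁ + d₀′ + slope σ     ≡⟨ xy∙z≈xz∙y d₁ d₀′ (slope σ) ⟩
    d₁ + slope σ + d₀′     ≡⟨ cong (_+ d₀′) (slope-spec σ) ⟩
    d₀ + 1 + d₀′          ≡⟨ solve (d₀ ∷ d₀′ ∷ []) ⟩
    d₀′ + 1 + d₀          ≡⟨ cong (_+ d₀) (slope-spec σ′) ⟨
    d₁′ + slope σ′ + d₀    ≡⟨ xy∙z≈xz∙y d₁′ (slope σ′) d₀ ⟩
    d₁′ + d₀ + slope σ′    ≡⟨ cong (_+ slope σ′) E₁ ⟨
    d₁ + d₀′ + slope σ′    ∎)
    where open ≡-Reasoning

  -- The two ties differ in d_h - d₀ (h - 1 versus 1 - h), as h ≥ 2.
  ties-differ : ∀ {d₀ dₕ d₀′ dₕ′} → dₕ + 1 ≡ d₀ + h → dₕ′ + h ≡ d₀′ + 1 → dₕ + d₀′ ≢ dₕ′ + d₀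
  ties-differ {d₀} {dₕ} {d₀′} {dₕ′} low high E =
    <⇒≢ 2≤h (sym (half-injective (+-cancelˡ-≡ (dₕ + d₀′ + dₕ′ + d₀) _ _ (begin
    dₕ + d₀′ + dₕ′ + d₀ + (h + h)       ≡⟨ solve (dₕ ∷ d₀′ ∷ dₕ′ ∷ d₀ ∷ h ∷ []) ⟩
    (d₀ + h) + (dₕ′ + h) + (dₕ + d₀′)   ≡⟨ cong₂ (λ u v → u + v + (dₕ + d₀′)) (sym low) high ⟩
    (dₕ + 1) + (d₀′ + 1) + (dₕ + d₀′)   ≡⟨ cong ((dₕ + 1) + (d₀′ + 1) +_) E ⟩
    (dₕ + 1) + (d₀′ + 1) + (dₕ′ + d₀)   ≡⟨ solve (dₕ ∷ d₀′ ∷ dₕ′ ∷ d₀ ∷ []) ⟩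
    dₕ + d₀′ + dₕ′ + d₀ + 2             ∎))))
    where open ≡-Reasoning

  same-slope-unique : ∀ {d₀ d₁ dₕ c d₀′ d₁′ dₕ′ c′}
                      (σ : Signature d₀ d₁ dₕ c) (σ′ : Signature d₀′ d₁′ dₕ′ c′) →
                      slope σ ≡ slope σ′ → dₕ + d₀′ ≡ dₕ′ + d₀ → c ≡ c′
  same-slope-unique {d₀} {_} {dₕ} {_} {d₀′} {_} {dₕ′} (nearer-c₁ _ e) (nearer-c₁ _ e′) _ E =
    cancel-offsets (trans e (+-assoc d₀ h 1)) (trans e′ (+-assoc d₀′ h 1))
                   (trans (+-comm d₀ dₕ′) (trans (sym E) (+-comm dₕ d₀′)))
  same-slope-unique (nearer-c₀ _ e) (nearer-c₀ _ e′) _ E =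
    cancel-offsets (trans e (regroup _)) (trans e′ (regroup _)) E
    where
      regroup : ∀ x → x + h + N + 1 ≡ x + (h + N + 1)
      regroup x = trans (cong (_+ 1) (+-assoc x h N)) (+-assoc x (h + N) 1)
  same-slope-unique (tie-low _ _ c≡2) (tie-low _ _ c′≡2) _ _ = trans c≡2 (sym c′≡2)
  same-slope-unique (tie-high _ _ c≡) (tie-high _ _ c′≡) _ _ = trans c≡ (sym c′≡)
  same-slope-unique (tie-low _ low _) (tie-high _ high _) _ E = contradiction E (ties-differ low high)
  same-slope-unique (tie-high _ high _) (tie-low _ low _) _ E = contradiction (sym E) (ties-differ low high)
  same-slope-unique (nearer-c₁ _ _)  (nearer-c₀ _ _)  ()
  same-slope-unique (nearer-c₁ _ _)  (tie-low _ _ _)  ()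
  same-slope-unique (nearer-c₁ _ _)  (tie-high _ _ _) ()
  same-slope-unique (nearer-c₀ _ _)  (nearer-c₁ _ _)  ()
  same-slope-unique (nearer-c₀ _ _)  (tie-low _ _ _)  ()
  same-slope-unique (nearer-c₀ _ _)  (tie-high _ _ _) ()
  same-slope-unique (tie-low _ _ _)  (nearer-c₁ _ _)  ()
  same-slope-unique (tie-low _ _ _)  (nearer-c₀ _ _)  ()
  same-slope-unique (tie-high _ _ _) (nearer-c₁ _ _)  ()
  same-slope-unique (tie-high _ _ _) (nearer-c₀ _ _)  ()

  signature-unique : ∀ {d₀ d₁ dₕ c d₀′ d₁′ dₕ′ c′} → Signature d₀ d₁ dₕ c → Signature d₀′ d₁′ dₕ′ c′ →
                     d₁ + d₀′ ≡ d₁′ + d₀ → dₕ + d₀′ ≡ dₕ′ + d₀ → c ≡ c′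
  signature-unique σ σ′ E₁ = same-slope-unique σ σ′ (slopes-agree σ σ′ E₁)

  -- Position of an edge: 2t + 1 for the cycle edge at t, 2t for the pendant
  -- edge at t; signature parameters are positions, possibly one lap further.
  Lap : Fin N → ℕ → Set
  Lap i T = (T ≡ toℕ i) ⊎ (T ≡ toℕ i + N)

  Locates : Edge → ℕ → Set
  Locates (cyc i)  c = ∃[ T ] (Lap i T × c ≡ suc (T + T))
  Locates (pend i) c = ∃[ T ] (Lap i T × c ≡ T + T)

  lap-injective : ∀ {i j T} → Lap i T → Lap j T → i ≡ j
  lap-injective (inj₁ e) (inj₁ e′) = Fin.toℕ-injective (trans (sym e) e′)
  lap-injective (inj₂ e) (inj₂ e′) = Fin.toℕ-injective (+-cancelʳ-≡ N _ _ (trans (sym e) e′))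
  lap-injective {i} (inj₁ e) (inj₂ e′) = contradiction e (lapped (Fin.toℕ<n i) e′)
  lap-injective {j = j} (inj₂ e) (inj₁ e′) = contradiction e′ (lapped (Fin.toℕ<n j) e)

  locates-injective : ∀ {e f c} → Locates e c → Locates f c → e ≡ f
  locates-injective {cyc _} {cyc _} (T , l , eq) (T′ , l′ , eq′) =
    cong cyc (lap-injective l (subst (Lap _) (sym (half-injective (suc-injective (trans (sym eq) eq′)))) l′))
  locates-injective {pend _} {pend _} (T , l , eq) (T′ , l′ , eq′) =
    cong pend (lap-injective l (subst (Lap _) (sym (half-injective (trans (sym eq) eq′))) l′))
  locates-injective {cyc _} {pend _} (T , _ , eq) (T′ , _ , eq′) =
    contradiction (trans (sym eq′) eq) (double≢odd T′ T)
  locates-injective {pend _} {cyc _} (T , _ , eq) (T′ , _ , eq′) =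
    contradiction (trans (sym eq) eq′) (double≢odd T T′)

  classify-cyc : ∀ {t k₁ kₕ} → t < N → Wraps 1 t k₁ → k₁ < N → Wraps h t kₕ → kₕ < N →
                 ∃[ T ] ((T ≡ t ⊎ T ≡ t + N) × Signature (q t) (q k₁) (q kₕ) (suc (T + T)))
  classify-cyc {zero} _ w₁ _ wₕ _ =
    N , inj₂ refl , cyc-origin (wraps-high w₁ (s≤s z≤n)) (wraps-high wₕ (≤-trans (s≤s z≤n) 2≤h))
  classify-cyc {t@(suc _)} t<N w₁ k₁<N wₕ kₕ<N with t + t ≤? N
  ... | yes le = t , inj₁ refl , cyc-first-half (s≤s z≤n) le (wraps-low w₁ (s≤s z≤n) k₁<N) wₕ kₕ<N
  ... | no nle with m≤n⇒m<n∨m≡n (≰⇒> nle)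
  ...   | inj₁ lt = t , inj₁ refl , cyc-second-half lt t<N (wraps-low w₁ (s≤s z≤n) k₁<N)
                      (wraps-low wₕ (half-mono-≤ (≤-trans 2h≤1+N (≰⇒> nle))) kₕ<N)
  ...   | inj₂ eq = t , inj₁ refl , cyc-middle (sym eq) t<N (wraps-low w₁ (s≤s z≤n) k₁<N)
                      (wraps-low wₕ (half-mono-≤ (≤-trans 2h≤1+N (≰⇒> nle))) kₕ<N)

  classify-pend : ∀ {t k₁ kₕ} → t < N → Wraps 1 t k₁ → k₁ < N → Wraps h t kₕ → kₕ < N →
                  ∃[ T ] ((T ≡ t ⊎ T ≡ t + N) × Signature (p t) (p k₁) (p kₕ) (T + T))
  classify-pend {zero} _ w₁ _ wₕ _ =
    N , inj₂ refl , pend-origin (wraps-high w₁ (s≤s z≤n)) (wraps-high wₕ (≤-trans (s≤s z≤n) 2≤h))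
  classify-pend {suc zero} _ w₁ k₁<N wₕ kₕ<N =
    1 , inj₁ refl , pend-one (wraps-low w₁ ≤-refl k₁<N) (wraps-high wₕ 2≤h) kₕ<N
  classify-pend {t@(suc (suc _))} t<N w₁ k₁<N wₕ kₕ<N with t + t ≤? suc N
  ... | yes le = t , inj₁ refl , pend-first-half (s≤s (s≤s z≤n)) le (wraps-low w₁ (s≤s z≤n) k₁<N) wₕ kₕ<N
  ... | no nle with m≤n⇒m<n∨m≡n (≰⇒> nle)
  ...   | inj₁ lt = t , inj₁ refl , pend-second-half lt t<N (wraps-low w₁ (s≤s z≤n) k₁<N)
                      (wraps-low wₕ (half-mono-≤ (≤-trans (≤-trans 2h≤1+N (n≤1+n _)) (≰⇒> nle))) kₕ<N)
  ...   | inj₂ eq = t , inj₁ refl , pend-middle (sym eq) t<N (wraps-low w₁ (s≤s z≤n) k₁<N)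
                      (wraps-low wₕ (half-mono-≤ (≤-trans (≤-trans 2h≤1+N (n≤1+n _)) (≰⇒> nle))) kₕ<N)

  vertex : ∀ k → k < N → Fin N
  vertex k k<N = fromℕ< k<N

  1<N : 1 < N
  1<N = ≤-trans 2≤h (<⇒≤ h<N)

  v₀ v₁ vₕ : Fin N
  v₀ = vertex 0 (s≤s z≤n)
  v₁ = vertex 1 1<N
  vₕ = vertex h h<N

  c₀ c₁ cₕ : Edge
  c₀ = cyc v₀
  c₁ = cyc v₁
  cₕ = cyc vₕ

  d₀ d₁ dₕ : Edge → ℕ
  d₀ = dist c₀
  d₁ = dist c₁
  dₕ = dist cₕ

  wraps-at : ∀ i k (k<N : k < N) → Wraps k (toℕ i) (offset i (vertex k k<N))
  wraps-at i k k<N =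
    subst (λ α → Wraps α (toℕ i) (offset i (vertex k k<N))) (Fin.toℕ-fromℕ< k<N) (offset-wraps i (vertex k k<N))

  dist-cyc : ∀ a i → dist (cyc a) (cyc i) ≡ q (offset i a)
  dist-cyc a i with cyc i ≟E cyc a
  ... | yes refl = cong q (sym (offset-self a))
  ... | no  i≢a  = edge-dist-step-min (offset-next i a) λ off≡0 →
                     i≢a (cong cyc (offset-injective a (trans off≡0 (sym (offset-self a)))))

  dist-pend : ∀ a i → dist (cyc a) (pend i) ≡ p (offset i a)
  dist-pend a i = lift-off {cyc a} (λ j → edge-dist N (offset j a)) {pend i} λ ()

  retarget : ∀ {d₀ d₁ dₕ x₀ x₁ xₕ c} → d₀ ≡ x₀ → d₁ ≡ x₁ → dₕ ≡ xₕ →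
             Signature x₀ x₁ xₕ c → Signature d₀ d₁ dₕ c
  retarget refl refl refl σ = σ

  signature : ∀ e → ∃[ c ] (Locates e c × Signature (d₀ e) (d₁ e) (dₕ e) c)
  signature (cyc i)
    with classify-cyc (Fin.toℕ<n i) (wraps-at i 1 1<N) (offset< i v₁) (wraps-at i h h<N) (offset< i vₕ)
  ... | T , lap , σ = suc (T + T) , (T , lap , refl) ,
        retarget (trans (dist-cyc v₀ i) (cong q (offset-origin i))) (dist-cyc v₁ i) (dist-cyc vₕ i) σ
  signature (pend i)
    with classify-pend (Fin.toℕ<n i) (wraps-at i 1 1<N) (offset< i v₁) (wraps-at i h h<N) (offset< i vₕ)
  ... | T , lap , σ = T + T , (T , lap , refl) ,
        retarget (trans (dist-pend v₀ i) (cong p (offset-origin i))) (dist-pend v₁ i) (dist-pend vₕ i) σ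

  balanced-edges-coincide : ∀ {e f} → d₁ e + d₀ f ≡ d₁ f + d₀ e → dₕ e + d₀ f ≡ dₕ f + d₀ e → e ≡ f
  balanced-edges-coincide {e} {f} E₁ Eₕ with signature e | signature f
  ... | c , at-e , σ | c′ , at-f , σ′ =
    locates-injective at-e (subst (Locates f) (sym (signature-unique σ σ′ E₁ Eₕ)) at-f)

  open Resolving S dist dist-spec

  resolving-set : List Edge
  resolving-set = c₀ ∷ c₁ ∷ cₕ ∷ []

  resolving-set-is-DRS : IsEdgeDRS S resolving-set
  resolving-set-is-DRS e f e≢f with d₁ e + d₀ f ≟ d₁ f + d₀ e | dₕ e + d₀ f ≟ dₕ f + d₀ e
  ... | no unbalanced | _ = c₁ , c₀ , there (here refl) , here refl , unbalanced-resolves unbalanced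
  ... | yes _ | no unbalanced = cₕ , c₀ , there (there (here refl)) , here refl , unbalanced-resolves unbalanced
  ... | yes E₁ | yes Eₕ = contradiction (balanced-edges-coincide E₁ Eₕ) e≢f

  resolving-set-unique : Unique resolving-set
  resolving-set-unique = (c₀≢c₁ ∷ c₀≢cₕ ∷ []) ∷ (c₁≢cₕ ∷ []) ∷ [] ∷ []
    where
      open import Data.List.Relation.Unary.All using ([]; _∷_)
      open import Data.List.Relation.Unary.AllPairs using ([]; _∷_)
      toℕ-of : ∀ {i j} → cyc i ≡ cyc j → toℕ i ≡ toℕ j
      toℕ-of eq = cong toℕ (cyc-injective eq)
      c₀≢c₁ : c₀ ≢ c₁
      c₀≢c₁ eq = contradiction (trans (toℕ-of eq) (Fin.toℕ-fromℕ< 1<N)) λ ()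
      c₀≢cₕ : c₀ ≢ cₕ
      c₀≢cₕ eq = contradiction (subst (2 ≤_) (sym (trans (toℕ-of eq) (Fin.toℕ-fromℕ< h<N))) 2≤h) λ ()
      c₁≢cₕ : c₁ ≢ cₕ
      c₁≢cₕ eq = <⇒≢ 2≤h (trans (sym (Fin.toℕ-fromℕ< 1<N)) (trans (toℕ-of eq) (Fin.toℕ-fromℕ< h<N)))

ceil-half : ∀ N → ∃[ h ] (N ≡ h + h ⊎ suc N ≡ h + h)
ceil-half zero = 0 , inj₁ refl
ceil-half (suc N) with ceil-half N
... | h , inj₁ even = suc h , inj₂ (trans (cong (λ m → suc (suc m)) even) (cong suc (sym (+-suc h h))))
... | h , inj₂ odd  = h , inj₁ odd

theorem2p4 : (n : ℕ) → 4 ≤ n → ψE≡ (Sunlet n) 3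
theorem2p4 zero ()
theorem2p4 (suc m) 4≤n with ceil-half (suc m)
... | h , halves = (resolving-set , resolving-set-unique , resolving-set-is-DRS , refl) ,
                   λ D _ → three-≤-DRS 4≤n D
  where
    open UpperBound m h halves 4≤n
    open LowerBound m
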